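{- Let $F$ be a fullerene graph and let $S=\{e_1,e_2,e_3\}$ be a forcing set (of size $3$) of some perfect matching of $F$. Define $F_0':=F[V(S)]$ and $F_0'':=F-F_0'$. Recursively, if $F_i''$ has a vertex of degree $1$, let $F_{i+1}''$ be obtained from $F_i''$ by deleting such a degree-$1$ vertex together with its unique neighbour in $F_i''$, and set $F_{i+1}':=F-F_{i+1}''$. Let $X_i$ denote the set of edges of $F$ joining $F_i'$ to $F_i''$. Suppose $k\geq 1$ is such that $F_0'',\dots,F_{k}''$ are defined in this way (with $F_k''$ the first one having no vertex of degree $1$). Then $|X_{i+1}|\leq |X_i|\leq 12$ for $i=0,1,\ldots,k-1$.
   Context: A fullerene graph is a cubic $3$-connected plane graph all of whose faces are pentagons or hexagons. For a graph $G$ with a perfect matching $M$, a set $S\subseteq M$ is a forcing set of $M$ if $S$ is contained in no perfect matching of $G$ other than $M$. $F[U]$ denotes the subgraph induced by the vertex set $U$, and $F-F'$ denotes the subgraph induced by $V(F)\setminus V(F')$. -}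

module Defs where

open import Data.Nat using (ℕ; zero; suc; _+_; _*_; _≤_; _<_; _≤ᵇ_)
open import Data.Fin using (Fin; zero; suc; toℕ; _≟_)
open import Data.Bool using (Bool; true; false; if_then_else_; _∧_; _∨_; not)
open import Data.Product using (Σ; ∃; ∃-syntax; _×_; _,_)
open import Data.Sum using (_⊎_)
open import Relation.Binary.PropositionalEquality using (_≡_; _≢_)
open import Relation.Nullary.Decidable using (⌊_⌋)

sumF : ∀ {n} → (Fin n → ℕ) → ℕ
sumF {zero}  f = 0
sumF {suc n} f = f zero + sumF (λ x → f (suc x))

count : ∀ {n} → (Fin n → Bool) → ℕ
count p = sumF (λ x → if p x then 1 else 0)

allF : ∀ {n} → (Fin n → Bool) → Bool
allF {zero}  p = true
allF {suc n} p = p zero ∧ allF (λ x → p (suc x))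

anyF : ∀ {n} → (Fin n → Bool) → Bool
anyF {zero}  p = false
anyF {suc n} p = p zero ∨ anyF (λ x → p (suc x))

iter : ∀ {A : Set} → ℕ → (A → A) → A → A
iter zero    f x = x
iter (suc k) f x = f (iter k f x)

-- cyclic successor on Fin 3 (the rotation at a vertex)
next3 : Fin 3 → Fin 3
next3 zero             = suc zero
next3 (suc zero)       = suc (suc zero)
next3 (suc (suc zero)) = zero

-- Cubic simple graphs on vertex set Fin n, together with a rotation
-- system (combinatorial embedding): the neighbours of v in clockwise
-- order are  nb v 0, nb v 1, nb v 2.

record CubicMap (n : ℕ) : Set where
  field
    nb       : Fin n → Fin 3 → Fin n
    back     : Fin n → Fin 3 → Fin 3
    nb-back  : ∀ v i → nb (nb v i) (back v i) ≡ v
    loopless : ∀ v i → nb v i ≢ v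
    simple   : ∀ v i j → nb v i ≡ nb v j → i ≡ j

module _ {n : ℕ} (G : CubicMap n) where
  open CubicMap G

  Adj : Fin n → Fin n → Set
  Adj u v = ∃[ i ] nb u i ≡ v

  -- darts (directed edges) v → nb v i
  Dart : Set
  Dart = Fin n × Fin 3

  -- face permutation: follow a dart, then turn to the next one in the rotation
  φ : Dart → Dart
  φ (v , i) = (nb v i , next3 (back v i))

  FaceLength : Dart → ℕ → Set
  FaceLength d k = (iter k φ d ≡ d) × (∀ j → 0 < j → j < k → iter j φ d ≢ d)

  dartIndex : Dart → ℕ
  dartIndex (v , i) = toℕ v * 3 + toℕ i

  -- d is the least dart of its face (valid when all faces have length ≤ 6)
  isFaceRep : Dart → Bool
  isFaceRep d = allF {6} (λ k → dartIndex d ≤ᵇ dartIndex (iter (toℕ k) φ d))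

  faceCount : ℕ
  faceCount = sumF (λ v → count (λ i → isFaceRep (v , i)))

  data Walk (P : Fin n → Set) : Fin n → Fin n → Set where
    here : ∀ {u} → P u → Walk P u u
    step : ∀ {u v w} → P u → Adj u v → Walk P v w → Walk P u w

  ThreeConnected : Set
  ThreeConnected = (4 ≤ n) ×
    (∀ a b u w → u ≢ a → u ≢ b → w ≢ a → w ≢ b →
       Walk (λ x → (x ≢ a) × (x ≢ b)) u w)

  -- fullerene: 3-connected cubic plane graph (spherical embedding given by
  -- the rotation system: Euler V - E + F = 2, i.e. 2F = V + 4 as E = 3V/2),
  -- all faces pentagons or hexagons
  IsFullerene : Set
  IsFullerene = ThreeConnected
              × (∀ d → FaceLength d 5 ⊎ FaceLength d 6)
              × (2 * faceCount ≡ n + 4)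

  -- perfect matching, given by the partner function
  IsPerfectMatching : (Fin n → Fin n) → Set
  IsPerfectMatching m = (∀ v → Adj v (m v)) × (∀ v → m (m v) ≡ v)

  -- S = {{a i , m (a i)} | i : Fin 3} is a forcing set of size 3 of m
  IsForcingSet3 : (Fin n → Fin n) → (Fin 3 → Fin n) → Set
  IsForcingSet3 m a =
      (∀ i j → i ≢ j → (a i ≢ a j) × (a i ≢ m (a j)))
    × (∀ m' → IsPerfectMatching m' → (∀ i → m' (a i) ≡ m (a i)) → ∀ v → m' v ≡ m v)

  inVS : (Fin n → Fin n) → (Fin 3 → Fin n) → Fin n → Bool
  inVS m a v = anyF (λ i → ⌊ v ≟ a i ⌋ ∨ ⌊ v ≟ m (a i) ⌋)

  degIn : (Fin n → Bool) → Fin n → ℕ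
  degIn U x = count (λ j → U (nb x j))

  ReductionStep : (Fin n → Bool) → (Fin n → Bool) → Set
  ReductionStep U U' = Σ (Fin n) λ x → Σ (Fin 3) λ j →
      (U x ≡ true) × (degIn U x ≡ 1) × (U (nb x j) ≡ true)
    × (∀ v → U' v ≡ (U v ∧ not ⌊ v ≟ x ⌋ ∧ not ⌊ v ≟ nb x j ⌋))

  cutSize : (Fin n → Bool) → ℕ
  cutSize U = sumF (λ v → count (λ j → not (U v) ∧ U (nb v j)))

-- Write the cut of a vertex set U as the sum, over
-- vertices v ∉ U, of the number of neighbours of v in U (cutTerm).
--  * Step (reduction-cut-mono): deleting a degree-1 vertex x of F[U] and its
--    neighbour y removes the two cut edges from x's other neighbours v₁, v₂
--    and creates at most the two edges at y other than yx.  Pointwise we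
--    have  δ v₁ + δ v₂ + cutTerm U' ≤ 2 δ y + cutTerm U,  and since both
--    indicator sums equal 2, summing gives cut U' ≤ cut U (sumF-transfer).
--  * Start (initial-cut-≤12): V(S) has at most 6 vertices, each with its
--    matching partner inside V(S), so each sends at most 2 edges into
--    F₀'' = F − V(S) (cut-≤-twice-complement).

module Submission where

open import Defs
open import Function using (_∘_)
open import Data.Nat using (ℕ; zero; suc; _≤_; _<_; _+_; z≤n; s≤s)
open import Data.Nat.Properties
  using ( ≤-refl; ≤-reflexive; ≤-trans; ≤-pred; <⇒≤; n≤0⇒n≡0; m≤m+n; +-suc
        ; +-mono-≤; +-monoˡ-≤; +-monoʳ-≤; +-cancelˡ-≤; +-commutativeSemigroup )
open import Algebra.Properties.CommutativeSemigroup +-commutativeSemigroup using (interchange)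
open import Data.Fin using (Fin; zero; suc; _≟_)
open import Data.Bool using (Bool; true; false; not; _∧_; _∨_; if_then_else_)
open import Data.Bool.Properties using (not-involutive; not-injective; ∨-zeroʳ; ∧-zeroʳ; ∧-identityʳ)
open import Data.Product using (_×_; _,_; ∃)
open import Data.Sum using (_⊎_; inj₁; inj₂)
open import Relation.Nullary using (yes; no; contradiction)
open import Relation.Nullary.Decidable using (⌊_⌋)
open import Relation.Binary.PropositionalEquality
  using (_≡_; _≢_; refl; sym; trans; cong; cong₂; subst; subst₂; module ≡-Reasoning)

≟-refl : ∀ {n} (c : Fin n) → ⌊ c ≟ c ⌋ ≡ true
≟-refl c with c ≟ c
... | yes _   = refl
... | no c≢c = contradiction refl c≢c

-- ⌊_⌋ does not compute through the successor case of _≟_, so we record it.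
≟-suc : ∀ {n} (u v : Fin n) → ⌊ suc u ≟ suc v ⌋ ≡ ⌊ u ≟ v ⌋
≟-suc u v with u ≟ v
... | yes _ = refl
... | no _  = refl

≟-sound : ∀ {n} {u v : Fin n} → ⌊ u ≟ v ⌋ ≡ true → u ≡ v
≟-sound {u = u} {v} h with u ≟ v
... | yes u≡v = u≡v

-- Case split on vertex equality; unlike splitting on _≟_ directly, it
-- leaves occurrences of _≟_ inside the goal (e.g. in δ below) untouched.
≡-or-≢ : ∀ {n} (u v : Fin n) → u ≡ v ⊎ u ≢ v
≡-or-≢ u v with u ≟ v
... | yes u≡v = inj₁ u≡v
... | no  u≢v = inj₂ u≢v

≟-false : ∀ {n} {u v : Fin n} → u ≢ v → ⌊ u ≟ v ⌋ ≡ false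
≟-false {u = u} {v} u≢v with u ≟ v
... | yes u≡v = contradiction u≡v u≢v
... | no _    = refl

∨-true-cases : ∀ {a b : Bool} → a ∨ b ≡ true → a ≡ true ⊎ b ≡ true
∨-true-cases {true}  _   = inj₁ refl
∨-true-cases {false} b≡t = inj₂ b≡t

∧-true-left : ∀ {a b : Bool} → a ∧ b ≡ true → a ≡ true
∧-true-left {true} _ = refl

sumF-mono : ∀ {n} {f g : Fin n → ℕ} → (∀ v → f v ≤ g v) → sumF f ≤ sumF g
sumF-mono {zero}  f≤g = z≤n
sumF-mono {suc n} f≤g = +-mono-≤ (f≤g zero) (sumF-mono (f≤g ∘ suc))

sumF-+ : ∀ {n} (f g : Fin n → ℕ) → sumF (λ v → f v + g v) ≡ sumF f + sumF g
sumF-+ {zero}  f g = refl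
sumF-+ {suc n} f g = begin
  f zero + g zero + sumF (λ v → f (suc v) + g (suc v))
    ≡⟨ cong (f zero + g zero +_) (sumF-+ (f ∘ suc) (g ∘ suc)) ⟩
  f zero + g zero + (sumF (f ∘ suc) + sumF (g ∘ suc))
    ≡⟨ interchange (f zero) (g zero) _ _ ⟩
  sumF f + sumF g ∎
  where open ≡-Reasoning

-- If f + h ≤ g + k pointwise and k carries no more total mass than h,
-- then Σ f ≤ Σ g: local surpluses of f are paid for by the bookkeeping terms.
sumF-transfer : ∀ {n} {f g h k : Fin n → ℕ} →
  (∀ v → h v + f v ≤ k v + g v) → sumF k ≤ sumF h → sumF f ≤ sumF g
sumF-transfer {f = f} {g} {h} {k} pointwise Σk≤Σh =
  +-cancelˡ-≤ (sumF h) (sumF f) (sumF g) (begin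
  sumF h + sumF f          ≡⟨ sumF-+ h f ⟨
  sumF (λ v → h v + f v)   ≤⟨ sumF-mono pointwise ⟩
  sumF (λ v → k v + g v)   ≡⟨ sumF-+ k g ⟩
  sumF k + sumF g          ≤⟨ +-monoˡ-≤ (sumF g) Σk≤Σh ⟩
  sumF h + sumF g          ∎)
  where open Data.Nat.Properties.≤-Reasoning

count-cong : ∀ {n} {p q : Fin n → Bool} → (∀ v → p v ≡ q v) → count p ≡ count q
count-cong {zero}  p≡q = refl
count-cong {suc n} p≡q =
  cong₂ _+_ (cong (λ b → if b then 1 else 0) (p≡q zero)) (count-cong (p≡q ∘ suc))

count-none : ∀ {n} → count {n} (λ _ → false) ≡ 0
count-none {zero}  = refl
count-none {suc n} = count-none {n}

count-all : ∀ {n} → count {n} (λ _ → true) ≡ n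
count-all {zero}  = refl
count-all {suc n} = cong suc (count-all {n})

count-≟ : ∀ {n} (c : Fin n) → count (λ v → ⌊ v ≟ c ⌋) ≡ 1
count-≟ {suc n} zero    = cong suc (count-none {n})
count-≟ {suc n} (suc c) = trans (count-cong (λ v → ≟-suc v c)) (count-≟ c)

indicator-mono : ∀ {a b : Bool} → (a ≡ true → b ≡ true) →
  (if a then 1 else 0) ≤ (if b then 1 else 0)
indicator-mono {false} a⇒b = z≤n
indicator-mono {true}  a⇒b rewrite a⇒b refl = ≤-refl

count-mono : ∀ {n} {p q : Fin n → Bool} →
  (∀ v → p v ≡ true → q v ≡ true) → count p ≤ count q
count-mono p⇒q = sumF-mono (λ v → indicator-mono (p⇒q v))

count-strict : ∀ {n} {p q : Fin n → Bool} → (∀ v → p v ≡ true → q v ≡ true) →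
  (i : Fin n) → p i ≡ false → q i ≡ true → suc (count p) ≤ count q
count-strict p⇒q zero    pi≡false qi≡true rewrite pi≡false | qi≡true =
  s≤s (count-mono (p⇒q ∘ suc))
count-strict {p = p} {q} p⇒q (suc i) pi≡false qi≡true =
  subst (_≤ count q) (+-suc (if p zero then 1 else 0) (count (p ∘ suc)))
    (+-mono-≤ (indicator-mono (p⇒q zero)) (count-strict (p⇒q ∘ suc) i pi≡false qi≡true))

count-missing : ∀ {n} {p : Fin n → Bool} (i : Fin n) → p i ≡ false → suc (count p) ≤ n
count-missing {n} {p} i pi≡false = subst (suc (count p) ≤_) (count-all {n})
  (count-strict {q = λ _ → true} (λ _ _ → refl) i pi≡false refl)

count-unique : ∀ {n} {p : Fin n → Bool} {i j : Fin n} →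
  count p ≤ 1 → p i ≡ true → p j ≡ true → i ≡ j
count-unique {p = p} {i} {j} count≤1 pi pj with i ≟ j
... | yes i≡j = i≡j
... | no  i≢j = contradiction (≤-trans two≤count count≤1) λ { (s≤s ()) }
  where
  two≤count : 2 ≤ count p
  two≤count = subst (λ c → suc c ≤ count p) (count-≟ j)
    (count-strict (λ v v≡j → subst (λ w → p w ≡ true) (sym (≟-sound v≡j)) pj) i (≟-false i≢j) pi)

count-∨ : ∀ {n} (p q : Fin n → Bool) → count (λ v → p v ∨ q v) ≤ count p + count q
count-∨ p q = subst (count (λ v → p v ∨ q v) ≤_)
  (sumF-+ (λ v → if p v then 1 else 0) (λ v → if q v then 1 else 0))
  (sumF-mono (λ v → indicator-∨ (p v) (q v)))
  where
  indicator-∨ : ∀ a b → (if a ∨ b then 1 else 0) ≤ (if a then 1 else 0) + (if b then 1 else 0)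
  indicator-∨ true  b     = s≤s z≤n
  indicator-∨ false true  = ≤-refl
  indicator-∨ false false = z≤n

count-anyF : ∀ {k n} (p : Fin k → Fin n → Bool) →
  count (λ v → anyF (λ i → p i v)) ≤ sumF (λ i → count (p i))
count-anyF {zero} {n} p = ≤-reflexive (count-none {n})
count-anyF {suc k} p =
  ≤-trans (count-∨ (p zero) _) (+-monoʳ-≤ (count (p zero)) (count-anyF (p ∘ suc)))

anyF-witness : ∀ {n} (p : Fin n → Bool) → anyF p ≡ true → ∃ λ i → p i ≡ true
anyF-witness {suc n} p any with p zero in p0
... | true  = zero , p0
... | false with anyF-witness (p ∘ suc) any
...   | i , pi = suc i , pi

anyF-intro : ∀ {n} (p : Fin n → Bool) (i : Fin n) → p i ≡ true → anyF p ≡ true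
anyF-intro p zero    pi rewrite pi = refl
anyF-intro p (suc i) pi with p zero
... | true  = refl
... | false = anyF-intro (p ∘ suc) i pi

antitone-prefix : (f : ℕ → ℕ) (k : ℕ) → (∀ i → i < k → f (suc i) ≤ f i) →
  ∀ i → i ≤ k → f i ≤ f 0
antitone-prefix f k descends zero    _   = ≤-refl
antitone-prefix f k descends (suc i) i<k =
  ≤-trans (descends i i<k) (antitone-prefix f k descends i (<⇒≤ i<k))

next3-no-fixpoint : ∀ (j : Fin 3) → next3 j ≢ j
next3-no-fixpoint zero             ()
next3-no-fixpoint (suc zero)       ()
next3-no-fixpoint (suc (suc zero)) ()

next3²-no-fixpoint : ∀ (j : Fin 3) → next3 (next3 j) ≢ j
next3²-no-fixpoint zero             ()
next3²-no-fixpoint (suc zero)       ()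
next3²-no-fixpoint (suc (suc zero)) ()

δ : ∀ {n} → Fin n → Fin n → ℕ
δ c v = if ⌊ v ≟ c ⌋ then 1 else 0

δ-self : ∀ {n} (c : Fin n) → δ c c ≡ 1
δ-self c rewrite ≟-refl c = refl

δ-other : ∀ {n} {c v : Fin n} → v ≢ c → δ c v ≡ 0
δ-other v≢c rewrite ≟-false v≢c = refl

sumF-δ-pair : ∀ {n} (c d : Fin n) → sumF (λ v → δ c v + δ d v) ≡ 2
sumF-δ-pair c d = trans (sumF-+ (δ c) (δ d)) (cong₂ _+_ (count-≟ c) (count-≟ d))

count-pair : ∀ {n} (c d : Fin n) → count (λ v → ⌊ v ≟ c ⌋ ∨ ⌊ v ≟ d ⌋) ≤ 2
count-pair c d = ≤-trans (count-∨ (λ v → ⌊ v ≟ c ⌋) (λ v → ⌊ v ≟ d ⌋))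
  (≤-reflexive (cong₂ _+_ (count-≟ c) (count-≟ d)))

module CutCounting {n : ℕ} (F : CubicMap n) where
  open CubicMap F

  Adj-sym : ∀ {u v} → Adj F u v → Adj F v u
  Adj-sym {u} (i , refl) = back u i , nb-back u i

  _⊆_ : (Fin n → Bool) → (Fin n → Bool) → Set
  U' ⊆ U = ∀ v → U' v ≡ true → U v ≡ true

  cutTerm : (Fin n → Bool) → Fin n → ℕ
  cutTerm U v = count (λ j → not (U v) ∧ U (nb v j))

  cutTerm-inside : ∀ U v → U v ≡ true → cutTerm U v ≡ 0
  cutTerm-inside U v Uv rewrite Uv = count-none {3}

  cutTerm-outside : ∀ U v → U v ≡ false → cutTerm U v ≡ degIn F U v
  cutTerm-outside U v Uv rewrite Uv = refl

  degIn-mono : ∀ {U U'} → U' ⊆ U → ∀ v → degIn F U' v ≤ degIn F U v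
  degIn-mono U'⊆U v = count-mono (λ i → U'⊆U (nb v i))

  degIn-strict : ∀ {U U' v w} → U' ⊆ U → Adj F v w → U' w ≡ false → U w ≡ true →
    suc (degIn F U' v) ≤ degIn F U v
  degIn-strict U'⊆U (i , refl) U'w Uw = count-strict (λ i → U'⊆U (nb _ i)) i U'w Uw

  degIn-≤2 : ∀ U {v w} → Adj F v w → U w ≡ false → degIn F U v ≤ 2
  degIn-≤2 U {v} (i , refl) Uw = ≤-pred (count-missing {p = λ j → U (nb v j)} i Uw)

  cut-≤-twice-complement : ∀ U →
    (∀ v → U v ≡ false → ∃ λ w → Adj F v w × (U w ≡ false)) →
    cutSize F U ≤ count (not ∘ U) + count (not ∘ U)
  cut-≤-twice-complement U partner =
    subst (cutSize F U ≤_) (sumF-+ (χ ∘ U) (χ ∘ U)) (sumF-mono (λ v → bound v (U v) refl))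
    where
    χ : Bool → ℕ
    χ b = if not b then 1 else 0
    bound : ∀ v b → U v ≡ b → cutTerm U v ≤ χ b + χ b
    bound v true  Uv = ≤-reflexive (cutTerm-inside U v Uv)
    bound v false Uv with partner v Uv
    ... | w , v~w , Uw = ≤-trans (≤-reflexive (cutTerm-outside U v Uv)) (degIn-≤2 U v~w Uw)

  -- Let x have degree 1 in F[U] with U-neighbour y, let
  -- v₁, v₂ be the other neighbours of x, and U' = U ∖ {x, y}.  The edges
  -- v₁x and v₂x leave the cut, while at most the two edges at y other than
  -- yx enter it; sumF-transfer balances δ v₁ + δ v₂ against 2 δ y.
  reduction-cut-mono : ∀ {U U'} → ReductionStep F U U' → cutSize F U' ≤ cutSize F U
  reduction-cut-mono {U} {U'} (x , j , Ux , deg-x , Uy , U'-def) =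
    sumF-transfer {h = λ v → δ v₁ v + δ v₂ v} {k = λ v → δ y v + δ y v} balance
      (≤-reflexive (trans (sumF-δ-pair y y) (sym (sumF-δ-pair v₁ v₂))))
    where
    y v₁ v₂ : Fin n
    y  = nb x j
    v₁ = nb x (next3 j)
    v₂ = nb x (next3 (next3 j))

    U'⊆U : U' ⊆ U
    U'⊆U v U'v = ∧-true-left (trans (sym (U'-def v)) U'v)

    U'x : U' x ≡ false
    U'x rewrite U'-def x | Ux | ≟-refl x = refl

    U'y : U' y ≡ false
    U'y rewrite U'-def y | Uy | ≟-refl y = ∧-zeroʳ _

    U'-elsewhere : ∀ {v} → v ≢ x → v ≢ y → U' v ≡ U v
    U'-elsewhere {v} v≢x v≢y rewrite U'-def v | ≟-false v≢x | ≟-false v≢y =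
      ∧-identityʳ (U v)

    outside-U : ∀ {i} → i ≢ j → U (nb x i) ≡ false
    outside-U {i} i≢j with U (nb x i) in Uxi
    ... | true  = contradiction (count-unique (≤-reflexive deg-x) Uxi Uy) i≢j
    ... | false = refl

    Uv₁ : U v₁ ≡ false
    Uv₁ = outside-U (next3-no-fixpoint j)

    Uv₂ : U v₂ ≡ false
    Uv₂ = outside-U (next3²-no-fixpoint j)

    separated : ∀ {u w} → U u ≡ true → U w ≡ false → u ≢ w
    separated Uu Uw refl with () ← trans (sym Uu) Uw

    v₁≢v₂ : v₁ ≢ v₂
    v₁≢v₂ v₁≡v₂ = next3-no-fixpoint (next3 j) (sym (simple x _ _ v₁≡v₂))

    x-isolated : degIn F U' x ≡ 0
    x-isolated =
      n≤0⇒n≡0 (≤-pred (≤-trans (degIn-strict U'⊆U (j , refl) U'y Uy) (≤-reflexive deg-x)))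

    -- at x and y the bookkeeping vanishes resp. pays for up to two new edges
    at-x : δ v₁ x + δ v₂ x + cutTerm U' x ≤ δ y x + δ y x + cutTerm U x
    at-x rewrite δ-other (λ x≡v₁ → loopless x (next3 j) (sym x≡v₁))
               | δ-other (λ x≡v₂ → loopless x (next3 (next3 j)) (sym x≡v₂))
      = ≤-trans (≤-reflexive (trans (cutTerm-outside U' x U'x) x-isolated)) z≤n

    at-y : δ v₁ y + δ v₂ y + cutTerm U' y ≤ δ y y + δ y y + cutTerm U y
    at-y rewrite δ-other (separated Uy Uv₁) | δ-other (separated Uy Uv₂) | δ-self y =
      ≤-trans (≤-reflexive (cutTerm-outside U' y U'y))
        (≤-trans (degIn-≤2 U' (Adj-sym (j , refl)) U'x) (m≤m+n 2 (cutTerm U y)))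

    -- v loses one U-neighbour (namely x) for each occurrence among v₁, v₂
    losses : ∀ v → δ v₁ v + δ v₂ v + degIn F U' v ≤ degIn F U v
    losses v with ≡-or-≢ v v₁ | ≡-or-≢ v v₂
    ... | inj₁ refl | _ rewrite δ-self v₁ | δ-other v₁≢v₂ =
      degIn-strict U'⊆U (Adj-sym (next3 j , refl)) U'x Ux
    ... | inj₂ v≢v₁ | inj₁ refl rewrite δ-other v≢v₁ | δ-self v₂ =
      degIn-strict U'⊆U (Adj-sym (next3 (next3 j) , refl)) U'x Ux
    ... | inj₂ v≢v₁ | inj₂ v≢v₂ rewrite δ-other v≢v₁ | δ-other v≢v₂ =
      degIn-mono U'⊆U v

    -- a vertex other than x, y keeps its membership, so only losses matter
    away : ∀ {v} → v ≢ x → v ≢ y → ∀ b → U v ≡ b →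
      δ v₁ v + δ v₂ v + cutTerm U' v ≤ δ y v + δ y v + cutTerm U v
    away {v} v≢x v≢y true Uv
      rewrite δ-other (separated Uv Uv₁) | δ-other (separated Uv Uv₂) =
      ≤-trans (≤-reflexive (cutTerm-inside U' v (trans (U'-elsewhere v≢x v≢y) Uv))) z≤n
    away {v} v≢x v≢y false Uv
      rewrite δ-other v≢y =
      subst₂ (λ a b → δ v₁ v + δ v₂ v + a ≤ b)
        (sym (cutTerm-outside U' v (trans (U'-elsewhere v≢x v≢y) Uv)))
        (sym (cutTerm-outside U v Uv))
        (losses v)

    balance : ∀ v → δ v₁ v + δ v₂ v + cutTerm U' v ≤ δ y v + δ y v + cutTerm U v
    balance v with ≡-or-≢ v x | ≡-or-≢ v y
    ... | inj₁ refl | _         = at-x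
    ... | inj₂ _    | inj₁ refl = at-y
    ... | inj₂ v≢x  | inj₂ v≢y  = away v≢x v≢y (U v) refl

  VS-size : ∀ m (a : Fin 3 → Fin n) → count (inVS F m a) ≤ 6
  VS-size m a = ≤-trans (count-anyF (λ i v → ⌊ v ≟ a i ⌋ ∨ ⌊ v ≟ m (a i) ⌋))
    (sumF-mono {g = λ _ → 2} (λ i → count-pair (a i) (m (a i))))

  VS-member : ∀ m a w i → ⌊ w ≟ a i ⌋ ∨ ⌊ w ≟ m (a i) ⌋ ≡ true → inVS F m a w ≡ true
  VS-member m a w = anyF-intro (λ i → ⌊ w ≟ a i ⌋ ∨ ⌊ w ≟ m (a i) ⌋)

  VS-closed : ∀ m → (∀ v → m (m v) ≡ v) → ∀ a v →
    inVS F m a v ≡ true → inVS F m a (m v) ≡ true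
  VS-closed m m-invol a v v∈VS
    with anyF-witness (λ i → ⌊ v ≟ a i ⌋ ∨ ⌊ v ≟ m (a i) ⌋) v∈VS
  ... | i , hit with ∨-true-cases {⌊ v ≟ a i ⌋} hit
  ...   | inj₁ v≡ai rewrite ≟-sound v≡ai =
    VS-member m a (m (a i)) i
      (trans (cong (⌊ m (a i) ≟ a i ⌋ ∨_) (≟-refl (m (a i)))) (∨-zeroʳ _))
  ...   | inj₂ v≡mai rewrite ≟-sound v≡mai | m-invol (a i) =
    VS-member m a (a i) i (cong (_∨ ⌊ a i ≟ m (a i) ⌋) (≟-refl (a i)))

  initial-cut-≤12 : ∀ m → IsPerfectMatching F m → ∀ a U₀ →
    (∀ v → U₀ v ≡ not (inVS F m a v)) → cutSize F U₀ ≤ 12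
  initial-cut-≤12 m (m-adj , m-invol) a U₀ U₀-def = begin
    cutSize F U₀                             ≤⟨ cut-≤-twice-complement U₀ partner ⟩
    count (not ∘ U₀) + count (not ∘ U₀)      ≡⟨ cong (λ c → c + c) complement≡VS ⟩
    count (inVS F m a) + count (inVS F m a)  ≤⟨ +-mono-≤ (VS-size m a) (VS-size m a) ⟩
    12                                       ∎
    where
    open Data.Nat.Properties.≤-Reasoning
    ∈VS : ∀ {v} → U₀ v ≡ false → inVS F m a v ≡ true
    ∈VS {v} U₀v = not-injective (trans (sym (U₀-def v)) U₀v)
    partner : ∀ v → U₀ v ≡ false → ∃ λ w → Adj F v w × (U₀ w ≡ false)
    partner v U₀v =
      m v , m-adj v , trans (U₀-def (m v)) (cong not (VS-closed m m-invol a v (∈VS U₀v)))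
    complement≡VS : count (not ∘ U₀) ≡ count (inVS F m a)
    complement≡VS = count-cong (λ v → trans (cong not (U₀-def v)) (not-involutive _))

open CutCounting using (reduction-cut-mono; initial-cut-≤12)

lemma3p3 : ∀ {n} (F : CubicMap n) → IsFullerene F →
    (m : Fin n → Fin n) → IsPerfectMatching F m →
    (a : Fin 3 → Fin n) → IsForcingSet3 F m a →
    (k : ℕ) → 1 ≤ k →
    (U : ℕ → Fin n → Bool) →
    (∀ v → U 0 v ≡ not (inVS F m a v)) →
    (∀ i → i < k → ReductionStep F (U i) (U (suc i))) →
    (∀ x → U k x ≡ true → degIn F (U k) x ≢ 1) →
    ∀ i → i < k → (cutSize F (U (suc i)) ≤ cutSize F (U i)) × (cutSize F (U i) ≤ 12)
lemma3p3 F _ m pm a _ k _ U U₀-def steps _ i i<k =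
  cut-descends i i<k , ≤-trans below-initial (initial-cut-≤12 F m pm a (U 0) U₀-def)
  where
  cut-descends : ∀ i → i < k → cutSize F (U (suc i)) ≤ cutSize F (U i)
  cut-descends i i<k = reduction-cut-mono F (steps i i<k)
  below-initial : cutSize F (U i) ≤ cutSize F (U 0)
  below-initial = antitone-prefix (cutSize F ∘ U) k cut-descends i (<⇒≤ i<k)
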